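{- Let $k\ge 1$ and $\ell$ be integers and $n\ge 1$ an integer satisfying one of: (1) $\ell\in[0,k]$ and $n\ge 1$; (2) $\ell\in(k,\tfrac32 k)$ and $n\ge 2$; (3) $\ell\in[\tfrac32 k,2k)$ and either $n=2$ or $n\ge \frac{\ell}{2k-\ell}$. Let $K$ be the complete multigraph on the vertex set $\{1,\dots,n\}$ having $\max\{0,k-\ell\}$ loops at each vertex and $2k-\ell$ parallel edges between each pair of distinct vertices. Then the collection of edge sets of all $(k,\ell)$-tight graphs on the vertex set $\{1,\dots,n\}$ whose edges are edges of $K$ is the set of bases of a matroid on the ground set $E(K)$.
   Context: All graphs are finite multigraphs (loops and parallel edges allowed). For a graph $G=(V,E)$ with $n=|V|$ and $m=|E|$, $G$ is $(k,\ell)$-sparse if every subset $V'\subseteq V$ with $n'=|V'|$ vertices spans (induces) at most $\max\{0,kn'-\ell\}$ edges (loops included). $G$ is $(k,\ell)$-tight if it is $(k,\ell)$-sparse and $m=kn-\ell$. -}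

module Defs where

open import Data.Nat using (ℕ; zero; suc; _+_; _*_; _∸_; _≤_; _<_)
open import Data.Bool using (Bool; true; false; _∧_; if_then_else_)
open import Data.Fin as F using (Fin)
open import Data.Fin.Subset using (Subset; _∈_; _∉_; _-_; _∪_; ⁅_⁆; ∣_∣)
open import Data.Fin.Subset.Properties using (_∈?_)
open import Data.List as L using (List; []; _∷_; _++_; concatMap; replicate; allFin; length)
open import Data.Vec as V using (tabulate)
open import Data.Sum using (_⊎_; inj₁; inj₂)
open import Data.Product using (Σ; ∃; ∃-syntax; _×_; _,_; proj₁; proj₂)
open import Relation.Nullary.Decidable using (does; ⌊_⌋)
open import Relation.Binary.PropositionalEquality using (_≡_)

Edge : ℕ → Set
Edge n = Fin n × Fin n

-- The complete multigraph K(n,k,ℓ) on vertices Fin n (i.e. {1,…,n}),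
-- listed edge by edge (parallel copies are distinct list entries):
--   max{0,k-ℓ} = k ∸ ℓ loops at each vertex, and
--   2k-ℓ parallel edges between each pair u < v of distinct vertices
--   (for ℓ < 2k, 2k ∸ ℓ = 2k-ℓ).
KEdges : (n k ℓ : ℕ) → List (Edge n)
KEdges n k ℓ =
  concatMap (λ v → replicate (k ∸ ℓ) (v , v)) (allFin n)
  ++ concatMap (λ u → concatMap (λ v →
        if ⌊ u F.<? v ⌋ then replicate (2 * k ∸ ℓ) (u , v) else []) (allFin n))
       (allFin n)

-- Number of edges of K; the ground set E(K) is Fin (#E n k ℓ).
#E : (n k ℓ : ℕ) → ℕ
#E n k ℓ = length (KEdges n k ℓ)

ends : (n k ℓ : ℕ) → Fin (#E n k ℓ) → Edge n
ends n k ℓ i = L.lookup (KEdges n k ℓ) i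

induced : (n k ℓ : ℕ) → Subset (#E n k ℓ) → Subset n → Subset (#E n k ℓ)
induced n k ℓ B V' = tabulate λ i →
  ⌊ i ∈? B ⌋ ∧ ⌊ proj₁ (ends n k ℓ i) ∈? V' ⌋ ∧ ⌊ proj₂ (ends n k ℓ i) ∈? V' ⌋

-- (k,ℓ)-sparse: every V' spans at most max{0, k|V'| - ℓ} = k|V'| ∸ ℓ edges.
Sparse : (n k ℓ : ℕ) → Subset (#E n k ℓ) → Set
Sparse n k ℓ B = (V' : Subset n) → ∣ induced n k ℓ B V' ∣ ≤ k * ∣ V' ∣ ∸ ℓ

-- (k,ℓ)-tight: sparse and m = kn - ℓ (stated as m + ℓ = kn, exactly).
Tight : (n k ℓ : ℕ) → Subset (#E n k ℓ) → Set
Tight n k ℓ B = Sparse n k ℓ B × (∣ B ∣ + ℓ ≡ k * n)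

IsMatroidBases : (N : ℕ) → (Subset N → Set) → Set
IsMatroidBases N 𝓑 =
  (∃[ B ] 𝓑 B) ×
  (∀ B₁ B₂ → 𝓑 B₁ → 𝓑 B₂ → ∀ x → x ∈ B₁ → x ∉ B₂ →
     ∃[ y ] (y ∈ B₂ × y ∉ B₁ × 𝓑 ((B₁ - x) ∪ ⁅ y ⁆)))

-- Parameter range from the paper (ℓ is forced to be ≥ 0 by every case).
-- Case 3: n ≥ ℓ/(2k-ℓ) is written n(2k-ℓ) ≥ ℓ (2k-ℓ > 0 there).
Range : (k ℓ n : ℕ) → Set
Range k ℓ n =
  (ℓ ≤ k × 1 ≤ n)
  ⊎ ((k < ℓ × 2 * ℓ < 3 * k × 2 ≤ n)
  ⊎ (3 * k ≤ 2 * ℓ × ℓ < 2 * k × (n ≡ 2 ⊎ ℓ ≤ n * (2 * k ∸ ℓ))))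

-- Basis exchange is the augmentation property of (k, ℓ)-sparse edge sets, and it holds in any
-- multigraph. Call V critical for S when S already has k|V| - ℓ edges inside V. If S ∪ {y} is
-- not sparse for any y ∈ B ∖ S, every such y lies inside a critical set of S. Two critical sets
-- with k|C ∩ D| ≥ ℓ have a critical union (k|V| - ℓ is modular there, while induced edge counts
-- are supermodular), and if k|C ∩ D| < ℓ they share no edge of S. Merging thus yields critical
-- sets with pairwise disjoint S-edges that cover B ∖ S, and counting edges inside and outside
-- them gives |B| ≤ |S|.
--
-- For a first basis, with m = 2k - ℓ: one vertex with k - ℓ loops is tight when ℓ ≤ k, two
-- vertices joined by m edges are tight, and when 3k ≤ 2ℓ so is the complete graph of
-- multiplicity m on q - 1 vertices plus a vertex carrying the missing edges, where
-- m q < 2k ≤ m (q + 1). Adding a vertex joined by k edges, at most m to each old vertex, keeps a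
-- graph tight once the old graph has at least k / m vertices, which each case of the parameter
-- range allows.

module Submission where

open import Defs
open import Data.Bool using (Bool; true; false; _∧_; if_then_else_)
open import Data.Bool.Properties using (∧-zeroʳ)
open import Data.Fin as F using (Fin; zero; suc)
open import Data.Fin.Properties using (any?)
open import Data.Fin.Subset
open import Data.Fin.Subset.Properties
open import Data.List as L using (List; []; _∷_; _++_; foldr; length; allFin; replicate; concatMap; take)
open import Data.List.Properties using (length-take; length-++; length-map; length-replicate)
open import Data.List.Membership.Propositional using () renaming (_∈_ to _∈ₗ_; _∉_ to _∉ₗ_)
open import Data.List.Membership.Propositional.Properties using (∈-allFin; ∈-map⁺)
import Data.List.Membership.DecPropositional as DecMembership
open import Data.List.Relation.Unary.All as All using (All; []; _∷_; lookupAny; all?)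
open import Data.List.Relation.Unary.All.Properties using (¬All⇒Any¬; ─⁺)
import Data.List.Relation.Unary.All.Properties as Allₚ
open import Data.List.Relation.Unary.AllPairs using (AllPairs; []; _∷_)
open import Data.List.Relation.Unary.Any as Any using (Any)
open import Data.Nat using (ℕ; zero; suc; _+_; _*_; _∸_; _≤_; _<_; z≤n; s≤s; s≤s⁻¹; _≤?_; _<?_; NonZero; >-nonZero; _/_; _%_)
open import Data.Nat.Combinatorics using (nC1≡n; nCk+nC[k+1]≡[n+1]C[k+1]) renaming (_C_ to _choose_)
open import Data.Nat.DivMod using (m/n*n≤m; m≡m%n+[m/n]*n; m%n<n)
open import Data.Nat.Induction using (<-wellFounded)
open import Data.Nat.Properties
open import Data.Nat.Solver using (module +-*-Solver)
open import Data.Product using (∃; ∃-syntax; _×_; _,_; proj₁; proj₂; uncurry)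
import Data.Product as Product
open import Data.Product.Properties using (,-injective)
open import Data.Sum using (inj₁; inj₂)
open import Data.Vec as V using (_∷_; []; tabulate; here; there)
open import Data.Vec.Properties using ([]=⇒lookup; lookup⇒[]=; lookup∘tabulate; tabulate∘lookup; tabulate-cong; lookup-zipWith)
open import Function using (_∘_)
open import Induction.WellFounded using (Acc; acc)
open import Relation.Binary.Definitions using (DecidableEquality)
open import Relation.Binary.PropositionalEquality
open import Relation.Nullary using (¬_; Dec; yes; no; contradiction; ¬?)
open import Relation.Nullary.Decidable using (⌊_⌋; does; map′; _×-dec_; dec-true; dec-false; isYes≗does)

∣p∪q∣+∣p∩q∣≡∣p∣+∣q∣ : ∀ {n} (p q : Subset n) → ∣ p ∪ q ∣ + ∣ p ∩ q ∣ ≡ ∣ p ∣ + ∣ q ∣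
∣p∪q∣+∣p∩q∣≡∣p∣+∣q∣ []            []            = refl
∣p∪q∣+∣p∩q∣≡∣p∣+∣q∣ (outside ∷ p) (outside ∷ q) = ∣p∪q∣+∣p∩q∣≡∣p∣+∣q∣ p q
∣p∪q∣+∣p∩q∣≡∣p∣+∣q∣ (outside ∷ p) (inside  ∷ q) =
  trans (cong suc (∣p∪q∣+∣p∩q∣≡∣p∣+∣q∣ p q)) (sym (+-suc ∣ p ∣ ∣ q ∣))
∣p∪q∣+∣p∩q∣≡∣p∣+∣q∣ (inside  ∷ p) (outside ∷ q) = cong suc (∣p∪q∣+∣p∩q∣≡∣p∣+∣q∣ p q)
∣p∪q∣+∣p∩q∣≡∣p∣+∣q∣ (inside  ∷ p) (inside  ∷ q) = cong suc (begin
  ∣ p ∪ q ∣ + suc ∣ p ∩ q ∣  ≡⟨ +-suc ∣ p ∪ q ∣ ∣ p ∩ q ∣ ⟩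
  suc (∣ p ∪ q ∣ + ∣ p ∩ q ∣) ≡⟨ cong suc (∣p∪q∣+∣p∩q∣≡∣p∣+∣q∣ p q) ⟩
  suc (∣ p ∣ + ∣ q ∣)         ≡⟨ +-suc ∣ p ∣ ∣ q ∣ ⟨
  ∣ p ∣ + suc ∣ q ∣           ∎)
  where open ≡-Reasoning

∣p∪q∣≤∣p∣+∣q∣ : ∀ {n} (p q : Subset n) → ∣ p ∪ q ∣ ≤ ∣ p ∣ + ∣ q ∣
∣p∪q∣≤∣p∣+∣q∣ p q = ≤-trans (m≤m+n ∣ p ∪ q ∣ ∣ p ∩ q ∣) (≤-reflexive (∣p∪q∣+∣p∩q∣≡∣p∣+∣q∣ p q))

∣p∩q∣≡0⇒∣p∪q∣≡∣p∣+∣q∣ : ∀ {n} (p q : Subset n) → ∣ p ∩ q ∣ ≡ 0 → ∣ p ∪ q ∣ ≡ ∣ p ∣ + ∣ q ∣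
∣p∩q∣≡0⇒∣p∪q∣≡∣p∣+∣q∣ p q ∣p∩q∣≡0 = begin
  ∣ p ∪ q ∣             ≡⟨ +-identityʳ ∣ p ∪ q ∣ ⟨
  ∣ p ∪ q ∣ + 0         ≡⟨ cong (∣ p ∪ q ∣ +_) ∣p∩q∣≡0 ⟨
  ∣ p ∪ q ∣ + ∣ p ∩ q ∣ ≡⟨ ∣p∪q∣+∣p∩q∣≡∣p∣+∣q∣ p q ⟩
  ∣ p ∣ + ∣ q ∣         ∎
  where open ≡-Reasoning

∣p∣≡∣p∩q∣+∣p─q∣ : ∀ {n} (p q : Subset n) → ∣ p ∣ ≡ ∣ p ∩ q ∣ + ∣ p ─ q ∣
∣p∣≡∣p∩q∣+∣p─q∣ []            []            = refl
∣p∣≡∣p∩q∣+∣p─q∣ (outside ∷ p) (outside ∷ q) = ∣p∣≡∣p∩q∣+∣p─q∣ p q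
∣p∣≡∣p∩q∣+∣p─q∣ (outside ∷ p) (inside  ∷ q) = ∣p∣≡∣p∩q∣+∣p─q∣ p q
∣p∣≡∣p∩q∣+∣p─q∣ (inside  ∷ p) (inside  ∷ q) = cong suc (∣p∣≡∣p∩q∣+∣p─q∣ p q)
∣p∣≡∣p∩q∣+∣p─q∣ (inside  ∷ p) (outside ∷ q) =
  trans (cong suc (∣p∣≡∣p∩q∣+∣p─q∣ p q)) (sym (+-suc ∣ p ∩ q ∣ ∣ p ─ q ∣))

x∈p─q⇒x∉q : ∀ {n} {x : Fin n} (p q : Subset n) → x ∈ p ─ q → x ∉ q
x∈p─q⇒x∉q (_      ∷ p) (inside  ∷ q) ()         here
x∈p─q⇒x∉q (_      ∷ p) (_       ∷ q) (there x∈) (there x∈q) = x∈p─q⇒x∉q p q x∈ x∈q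

∩-mono-⊆ : ∀ {n} {p p′ q q′ : Subset n} → p ⊆ p′ → q ⊆ q′ → p ∩ q ⊆ p′ ∩ q′
∩-mono-⊆ {p = p} {q = q} p⊆p′ q⊆q′ x∈ =
  let x∈p , x∈q = x∈p∩q⁻ p q x∈ in x∈p∩q⁺ (p⊆p′ x∈p , q⊆q′ x∈q)

∪-mono-⊆ : ∀ {n} {p p′ q q′ : Subset n} → p ⊆ p′ → q ⊆ q′ → p ∪ q ⊆ p′ ∪ q′
∪-mono-⊆ {p = p} {q = q} p⊆p′ q⊆q′ x∈ with x∈p∪q⁻ p q x∈
... | inj₁ x∈p = x∈p∪q⁺ (inj₁ (p⊆p′ x∈p))
... | inj₂ x∈q = x∈p∪q⁺ (inj₂ (q⊆q′ x∈q))

∣p∩⁅x⁆∣≡0 : ∀ {n} {x : Fin n} (p : Subset n) → x ∉ p → ∣ p ∩ ⁅ x ⁆ ∣ ≡ 0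
∣p∩⁅x⁆∣≡0 {n} {x} p x∉p = n≤0⇒n≡0 (≤-trans (p⊆q⇒∣p∣≤∣q∣ p∩⁅x⁆⊆⊥) (≤-reflexive (∣⊥∣≡0 n)))
  where
  p∩⁅x⁆⊆⊥ : p ∩ ⁅ x ⁆ ⊆ ⊥
  p∩⁅x⁆⊆⊥ y∈ = let y∈p , y∈⁅x⁆ = x∈p∩q⁻ p ⁅ x ⁆ y∈
               in contradiction (subst (_∈ p) (x∈⁅y⁆⇒x≡y x y∈⁅x⁆) y∈p) x∉p

∣p∩⁅x⁆∣≡1 : ∀ {n} {x : Fin n} (p : Subset n) → x ∈ p → ∣ p ∩ ⁅ x ⁆ ∣ ≡ 1
∣p∩⁅x⁆∣≡1 {x = x} p x∈p = trans (cong ∣_∣ p∩⁅x⁆≡⁅x⁆) (∣⁅x⁆∣≡1 x)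
  where
  p∩⁅x⁆≡⁅x⁆ : p ∩ ⁅ x ⁆ ≡ ⁅ x ⁆
  p∩⁅x⁆≡⁅x⁆ = ⊆-antisym (p∩q⊆q p ⁅ x ⁆)
    (λ y∈⁅x⁆ → x∈p∩q⁺ (subst (_∈ p) (sym (x∈⁅y⁆⇒x≡y x y∈⁅x⁆)) x∈p , y∈⁅x⁆))

∣p∣≡1+∣p-x∣ : ∀ {n} {x : Fin n} (p : Subset n) → x ∈ p → ∣ p ∣ ≡ suc ∣ p - x ∣
∣p∣≡1+∣p-x∣ {x = x} p x∈p =
  trans (∣p∣≡∣p∩q∣+∣p─q∣ p ⁅ x ⁆) (cong (_+ ∣ p - x ∣) (∣p∩⁅x⁆∣≡1 p x∈p))

∣p∪⁅x⁆∣≡1+∣p∣ : ∀ {n} {x : Fin n} (p : Subset n) → x ∉ p → ∣ p ∪ ⁅ x ⁆ ∣ ≡ suc ∣ p ∣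
∣p∪⁅x⁆∣≡1+∣p∣ {x = x} p x∉p = begin
  ∣ p ∪ ⁅ x ⁆ ∣     ≡⟨ ∣p∩q∣≡0⇒∣p∪q∣≡∣p∣+∣q∣ p ⁅ x ⁆ (∣p∩⁅x⁆∣≡0 p x∉p) ⟩
  ∣ p ∣ + ∣ ⁅ x ⁆ ∣ ≡⟨ cong (∣ p ∣ +_) (∣⁅x⁆∣≡1 x) ⟩
  ∣ p ∣ + 1         ≡⟨ +-comm ∣ p ∣ 1 ⟩
  suc ∣ p ∣         ∎
  where open ≡-Reasoning

x∈tabulate⁺ : ∀ {n} {f : Fin n → Bool} {x} → f x ≡ true → x ∈ tabulate f
x∈tabulate⁺ {f = f} {x} fx = lookup⇒[]= x (tabulate f) (trans (lookup∘tabulate f x) fx)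

x∈tabulate⁻ : ∀ {n} {f : Fin n → Bool} {x} → x ∈ tabulate f → f x ≡ true
x∈tabulate⁻ {f = f} {x} x∈ = trans (sym (lookup∘tabulate f x)) ([]=⇒lookup x∈)

does-∈?≡lookup : ∀ {n} (x : Fin n) (p : Subset n) → does (x ∈? p) ≡ V.lookup p x
does-∈?≡lookup zero    (inside  ∷ p) = refl
does-∈?≡lookup zero    (outside ∷ p) = refl
does-∈?≡lookup (suc x) (_       ∷ p) = does-∈?≡lookup x p

private variable
  A B : Set

length-─≡ : ∀ {P : A → Set} {xs} (p : Any P xs) → suc (length (xs Any.─ p)) ≡ length xs
length-─≡ (Any.here _)  = refl
length-─≡ (Any.there p) = cong suc (length-─≡ p)

AllPairs-─ : ∀ {R : A → A → Set} {P : A → Set} {xs} (p : Any P xs) →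
             AllPairs R xs → AllPairs R (xs Any.─ p)
AllPairs-─ (Any.here _)  (_ ∷ rs) = rs
AllPairs-─ (Any.there p) (r ∷ rs) = ─⁺ p r ∷ AllPairs-─ p rs

count : (A → Bool) → List A → ℕ
count p []       = 0
count p (x ∷ xs) = if p x then suc (count p xs) else count p xs

count-++ : ∀ (p : A → Bool) xs ys → count p (xs ++ ys) ≡ count p xs + count p ys
count-++ p []       ys = refl
count-++ p (x ∷ xs) ys with p x
... | true  = cong suc (count-++ p xs ys)
... | false = count-++ p xs ys

count-map : ∀ (p : B → Bool) (f : A → B) xs → count p (L.map f xs) ≡ count (p ∘ f) xs
count-map p f []       = refl
count-map p f (x ∷ xs) with p (f x)
... | true  = cong suc (count-map p f xs)
... | false = count-map p f xs

count-replicate : ∀ (p : A → Bool) r x → count p (replicate r x) ≡ (if p x then r else 0)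
count-replicate p zero    x with p x
... | true  = refl
... | false = refl
count-replicate p (suc r) x with p x in px
... | true  = cong suc (trans (count-replicate p r x) (cong (if_then r else 0) px))
... | false = trans (count-replicate p r x) (cong (if_then r else 0) px)

count-++ˡ : ∀ (p : A → Bool) xs ys → count p xs ≤ count p (xs ++ ys)
count-++ˡ p xs ys = ≤-trans (m≤m+n (count p xs) (count p ys)) (≤-reflexive (sym (count-++ p xs ys)))

count-++ʳ : ∀ (p : A → Bool) xs ys → count p ys ≤ count p (xs ++ ys)
count-++ʳ p xs ys = ≤-trans (m≤n+m (count p ys) (count p xs)) (≤-reflexive (sym (count-++ p xs ys)))

count-concatMap : ∀ (p : B → Bool) (f : A → List B) {x xs} → x ∈ₗ xs →
                  count p (f x) ≤ count p (concatMap f xs)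
count-concatMap p f {xs = y ∷ ys} (Any.here refl) = count-++ˡ p (f y) (concatMap f ys)
count-concatMap p f {xs = y ∷ ys} (Any.there x∈) =
  ≤-trans (count-concatMap p f x∈) (count-++ʳ p (f y) (concatMap f ys))

count-≗ : ∀ {p q : A → Bool} → (∀ x → p x ≡ q x) → ∀ xs → count p xs ≡ count q xs
count-≗ p≗q []       = refl
count-≗ p≗q (x ∷ xs) rewrite p≗q x = cong (λ c → if _ then suc c else c) (count-≗ p≗q xs)

count-false : ∀ (xs : List A) → count (λ _ → false) xs ≡ 0
count-false []       = refl
count-false (x ∷ xs) = count-false xs

count≤length : ∀ (p : A → Bool) xs → count p xs ≤ length xs
count≤length p []       = z≤n
count≤length p (x ∷ xs) with p x
... | true  = s≤s (count≤length p xs)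
... | false = m≤n⇒m≤1+n (count≤length p xs)

count-take : ∀ (p : A → Bool) t xs → count p (take t xs) ≤ count p xs
count-take p zero    xs       = z≤n
count-take p (suc t) []       = z≤n
count-take p (suc t) (x ∷ xs) with p x
... | true  = s≤s (count-take p t xs)
... | false = count-take p t xs

count-∷-cancel : ∀ (p : A → Bool) x xs ys → count p (x ∷ xs) ≤ count p (x ∷ ys) → count p xs ≤ count p ys
count-∷-cancel p x xs ys le with p x
... | true  = s≤s⁻¹ le
... | false = le

count-─ : ∀ (p : A → Bool) {x xs} (x∈xs : x ∈ₗ xs) → count p xs ≡ count p (x ∷ (xs Any.─ x∈xs))
count-─ p (Any.here refl) = refl
count-─ p {x} (Any.there {x = y} x∈xs) with count-─ p x∈xs
... | ih with p x | p y
...   | true  | true  = cong suc ih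
...   | true  | false = ih
...   | false | true  = cong suc ih
...   | false | false = ih

-- Count matroids of a multigraph

induces : ∀ {n} → Subset n → Edge n → Bool
induces V e = does (proj₁ e ∈? V) ∧ does (proj₂ e ∈? V)

induces⁺ : ∀ {n} {V : Subset n} e → proj₁ e ∈ V → proj₂ e ∈ V → induces V e ≡ true
induces⁺ {V = V} (u , v) u∈V v∈V with u ∈? V | v ∈? V
... | yes _   | yes _   = refl
... | no  u∉V | _       = contradiction u∈V u∉V
... | yes _   | no  v∉V = contradiction v∈V v∉V

induces⁻ : ∀ {n} {V : Subset n} e → induces V e ≡ true → proj₁ e ∈ V × proj₂ e ∈ V
induces⁻ {V = V} (u , v) eq with u ∈? V | v ∈? V
... | yes u∈V | yes v∈V = u∈V , v∈V

module CountMatroid {N n : ℕ} (ends : Fin N → Edge n) (k ℓ : ℕ) where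

  span : Subset n → Subset N
  span V = tabulate (induces V ∘ ends)

  edges : Subset N → Subset n → ℕ
  edges S V = ∣ S ∩ span V ∣

  bound : Subset n → ℕ
  bound V = k * ∣ V ∣ ∸ ℓ

  IsSparse : Subset N → Set
  IsSparse S = ∀ V → edges S V ≤ bound V

  Critical : Subset N → Subset n → Set
  Critical S V = bound V ≤ edges S V

  -- k |C ∩ D| < ℓ makes bound (C ∩ D) = 0, so C ∩ D spans no edge of a sparse set.
  Apart : Subset n → Subset n → Set
  Apart C D = k * ∣ C ∩ D ∣ < ℓ

  ∈span⁺ : ∀ {V i} → proj₁ (ends i) ∈ V → proj₂ (ends i) ∈ V → i ∈ span V
  ∈span⁺ {i = i} u∈V v∈V = x∈tabulate⁺ (induces⁺ (ends i) u∈V v∈V)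

  ∈span⁻ : ∀ {V i} → i ∈ span V → proj₁ (ends i) ∈ V × proj₂ (ends i) ∈ V
  ∈span⁻ {i = i} i∈ = induces⁻ (ends i) (x∈tabulate⁻ i∈)

  span-∩ : ∀ A B → span A ∩ span B ⊆ span (A ∩ B)
  span-∩ A B i∈ =
    let i∈A , i∈B = x∈p∩q⁻ (span A) (span B) i∈
        u∈A , v∈A = ∈span⁻ i∈A
        u∈B , v∈B = ∈span⁻ i∈B
    in ∈span⁺ (x∈p∩q⁺ (u∈A , u∈B)) (x∈p∩q⁺ (v∈A , v∈B))

  span-∪ : ∀ A B → span A ∪ span B ⊆ span (A ∪ B)
  span-∪ A B i∈ with x∈p∪q⁻ (span A) (span B) i∈
  ... | inj₁ i∈A = let u∈ , v∈ = ∈span⁻ i∈A in ∈span⁺ (x∈p∪q⁺ (inj₁ u∈)) (x∈p∪q⁺ (inj₁ v∈))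
  ... | inj₂ i∈B = let u∈ , v∈ = ∈span⁻ i∈B in ∈span⁺ (x∈p∪q⁺ (inj₂ u∈)) (x∈p∪q⁺ (inj₂ v∈))

  edges-supermodular : ∀ S A B → edges S A + edges S B ≤ edges S (A ∪ B) + edges S (A ∩ B)
  edges-supermodular S A B = begin
    edges S A + edges S B
      ≡⟨ ∣p∪q∣+∣p∩q∣≡∣p∣+∣q∣ (S ∩ span A) (S ∩ span B) ⟨
    ∣ (S ∩ span A) ∪ (S ∩ span B) ∣ + ∣ (S ∩ span A) ∩ (S ∩ span B) ∣
      ≤⟨ +-mono-≤ (p⊆q⇒∣p∣≤∣q∣ ∪-part) (p⊆q⇒∣p∣≤∣q∣ ∩-part) ⟩
    edges S (A ∪ B) + edges S (A ∩ B)
      ∎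
    where
    open ≤-Reasoning
    ∪-part : (S ∩ span A) ∪ (S ∩ span B) ⊆ S ∩ span (A ∪ B)
    ∪-part i∈ with x∈p∪q⁻ (S ∩ span A) (S ∩ span B) i∈
    ... | inj₁ i∈SA = let i∈S , i∈A = x∈p∩q⁻ S (span A) i∈SA in
                      x∈p∩q⁺ (i∈S , span-∪ A B (x∈p∪q⁺ (inj₁ i∈A)))
    ... | inj₂ i∈SB = let i∈S , i∈B = x∈p∩q⁻ S (span B) i∈SB in
                      x∈p∩q⁺ (i∈S , span-∪ A B (x∈p∪q⁺ (inj₂ i∈B)))
    ∩-part : (S ∩ span A) ∩ (S ∩ span B) ⊆ S ∩ span (A ∩ B)
    ∩-part i∈ = let i∈SA , i∈SB = x∈p∩q⁻ (S ∩ span A) (S ∩ span B) i∈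
                    i∈S , i∈A = x∈p∩q⁻ S (span A) i∈SA
                in x∈p∩q⁺ (i∈S , span-∩ A B (x∈p∩q⁺ (i∈A , proj₂ (x∈p∩q⁻ S (span B) i∈SB))))

  bound-modular : ∀ A B → ℓ ≤ k * ∣ A ∩ B ∣ → bound (A ∪ B) + bound (A ∩ B) ≡ bound A + bound B
  bound-modular A B ℓ≤ = begin
    bound (A ∪ B) + bound (A ∩ B)                 ≡⟨ ∸-distrib-+ ℓ≤∪ ℓ≤ ⟩
    (k * ∣ A ∪ B ∣ + k * ∣ A ∩ B ∣) ∸ (ℓ + ℓ)     ≡⟨ cong (_∸ (ℓ + ℓ)) k-modular ⟩
    (k * ∣ A ∣ + k * ∣ B ∣) ∸ (ℓ + ℓ)             ≡⟨ ∸-distrib-+ ℓ≤A ℓ≤B ⟨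
    bound A + bound B                             ∎
    where
    open ≡-Reasoning
    ∸-distrib-+ : ∀ {x y} → ℓ ≤ x → ℓ ≤ y → (x ∸ ℓ) + (y ∸ ℓ) ≡ (x + y) ∸ (ℓ + ℓ)
    ∸-distrib-+ {x} {y} ℓ≤x ℓ≤y = begin
      (x ∸ ℓ) + (y ∸ ℓ)   ≡⟨ +-∸-assoc (x ∸ ℓ) ℓ≤y ⟨
      (x ∸ ℓ) + y ∸ ℓ     ≡⟨ cong (_∸ ℓ) (+-∸-comm y ℓ≤x) ⟨
      (x + y) ∸ ℓ ∸ ℓ     ≡⟨ ∸-+-assoc (x + y) ℓ ℓ ⟩
      (x + y) ∸ (ℓ + ℓ)   ∎
    k-modular : k * ∣ A ∪ B ∣ + k * ∣ A ∩ B ∣ ≡ k * ∣ A ∣ + k * ∣ B ∣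
    k-modular = begin
      k * ∣ A ∪ B ∣ + k * ∣ A ∩ B ∣  ≡⟨ *-distribˡ-+ k ∣ A ∪ B ∣ ∣ A ∩ B ∣ ⟨
      k * (∣ A ∪ B ∣ + ∣ A ∩ B ∣)    ≡⟨ cong (k *_) (∣p∪q∣+∣p∩q∣≡∣p∣+∣q∣ A B) ⟩
      k * (∣ A ∣ + ∣ B ∣)            ≡⟨ *-distribˡ-+ k ∣ A ∣ ∣ B ∣ ⟩
      k * ∣ A ∣ + k * ∣ B ∣          ∎
    ℓ≤A : ℓ ≤ k * ∣ A ∣
    ℓ≤A = ≤-trans ℓ≤ (*-monoʳ-≤ k (∣p∩q∣≤∣p∣ A B))
    ℓ≤B : ℓ ≤ k * ∣ B ∣
    ℓ≤B = ≤-trans ℓ≤ (*-monoʳ-≤ k (∣p∩q∣≤∣q∣ A B))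
    ℓ≤∪ : ℓ ≤ k * ∣ A ∪ B ∣
    ℓ≤∪ = ≤-trans ℓ≤A (*-monoʳ-≤ k (∣p∣≤∣p∪q∣ A B))

  sparse-⊆ : ∀ {S T} → S ⊆ T → IsSparse T → IsSparse S
  sparse-⊆ S⊆T sparse V = ≤-trans (p⊆q⇒∣p∣≤∣q∣ (∩-mono-⊆ S⊆T ⊆-refl)) (sparse V)

  critical-∪ : ∀ {S A B} → IsSparse S → Critical S A → Critical S B → ¬ Apart A B →
               Critical S (A ∪ B)
  critical-∪ {S} {A} {B} sparse crA crB ¬apart = +-cancelʳ-≤ (bound (A ∩ B)) _ _ (begin
    bound (A ∪ B) + bound (A ∩ B)   ≡⟨ bound-modular A B (≮⇒≥ ¬apart) ⟩
    bound A + bound B               ≤⟨ +-mono-≤ crA crB ⟩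
    edges S A + edges S B           ≤⟨ edges-supermodular S A B ⟩
    edges S (A ∪ B) + edges S (A ∩ B) ≤⟨ +-monoʳ-≤ (edges S (A ∪ B)) (sparse (A ∩ B)) ⟩
    edges S (A ∪ B) + bound (A ∩ B) ∎)
    where open ≤-Reasoning

  apart⇒edges≡0 : ∀ {S C D} → IsSparse S → Apart C D → edges S (C ∩ D) ≡ 0
  apart⇒edges≡0 {C = C} {D} sparse apart =
    n≤0⇒n≡0 (≤-trans (sparse (C ∩ D)) (≤-reflexive (m≤n⇒m∸n≡0 (<⇒≤ apart))))

  cover : List (Subset n) → Subset N
  cover = foldr (λ C → span C ∪_) ⊥

  span⊆cover : ∀ {C F} → C ∈ₗ F → span C ⊆ cover F
  span⊆cover {F = D ∷ F} (Any.here refl) = p⊆p∪q (cover F)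
  span⊆cover {F = D ∷ F} (Any.there C∈F) = ⊆-trans (span⊆cover C∈F) (q⊆p∪q (span D) (cover F))

  ∣p∩cover[]∣≡0 : ∀ X → ∣ X ∩ cover [] ∣ ≡ 0
  ∣p∩cover[]∣≡0 X = trans (cong ∣_∣ (∩-zeroʳ X)) (∣⊥∣≡0 N)

  apart-disjoint : ∀ {S C F} → IsSparse S → All (Apart C) F → ∣ (S ∩ span C) ∩ cover F ∣ ≡ 0
  apart-disjoint {S} {C} {[]}    sparse []               = ∣p∩cover[]∣≡0 (S ∩ span C)
  apart-disjoint {S} {C} {D ∷ F} sparse (apart ∷ aparts) = n≤0⇒n≡0 (begin
    ∣ X ∩ (span D ∪ cover F) ∣           ≡⟨ cong ∣_∣ (∩-distribˡ-∪ X (span D) (cover F)) ⟩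
    ∣ (X ∩ span D) ∪ (X ∩ cover F) ∣     ≤⟨ ∣p∪q∣≤∣p∣+∣q∣ (X ∩ span D) (X ∩ cover F) ⟩
    ∣ X ∩ span D ∣ + ∣ X ∩ cover F ∣     ≤⟨ +-monoˡ-≤ _ (p⊆q⇒∣p∣≤∣q∣ X∩D⊆) ⟩
    edges S (C ∩ D) + ∣ X ∩ cover F ∣    ≡⟨ cong₂ _+_ (apart⇒edges≡0 {S} {C} {D} sparse apart)
                                                      (apart-disjoint {S} {C} sparse aparts) ⟩
    0                                    ∎)
    where
    open ≤-Reasoning
    X = S ∩ span C
    X∩D⊆ : X ∩ span D ⊆ S ∩ span (C ∩ D)
    X∩D⊆ i∈ = let i∈X , i∈D = x∈p∩q⁻ X (span D) i∈
                  i∈S , i∈C = x∈p∩q⁻ S (span C) i∈X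
              in x∈p∩q⁺ (i∈S , span-∩ C D (x∈p∩q⁺ (i∈C , i∈D)))

  ∣B∩cover∣≤∣S∩cover∣ : ∀ {S B F} → IsSparse S → IsSparse B → All (Critical S) F → AllPairs Apart F →
                ∣ B ∩ cover F ∣ ≤ ∣ S ∩ cover F ∣
  ∣B∩cover∣≤∣S∩cover∣ {S} {B} {[]}    _ _ [] [] =
    ≤-reflexive (trans (∣p∩cover[]∣≡0 B) (sym (∣p∩cover[]∣≡0 S)))
  ∣B∩cover∣≤∣S∩cover∣ {S} {B} {C ∷ F} spS spB (crC ∷ crF) (apartC ∷ apartF) = begin
    ∣ B ∩ (span C ∪ cover F) ∣         ≡⟨ cong ∣_∣ (∩-distribˡ-∪ B (span C) (cover F)) ⟩
    ∣ (B ∩ span C) ∪ (B ∩ cover F) ∣   ≤⟨ ∣p∪q∣≤∣p∣+∣q∣ (B ∩ span C) (B ∩ cover F) ⟩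
    edges B C + ∣ B ∩ cover F ∣        ≤⟨ +-mono-≤ (≤-trans (spB C) crC)
                                                    (∣B∩cover∣≤∣S∩cover∣ {S} {B} spS spB crF apartF) ⟩
    edges S C + ∣ S ∩ cover F ∣        ≡⟨ ∣p∩q∣≡0⇒∣p∪q∣≡∣p∣+∣q∣ (S ∩ span C) (S ∩ cover F) disjoint ⟨
    ∣ (S ∩ span C) ∪ (S ∩ cover F) ∣   ≡⟨ cong ∣_∣ (∩-distribˡ-∪ S (span C) (cover F)) ⟨
    ∣ S ∩ (span C ∪ cover F) ∣         ∎
    where
    open ≤-Reasoning
    disjoint : ∣ (S ∩ span C) ∩ (S ∩ cover F) ∣ ≡ 0
    disjoint = n≤0⇒n≡0 (≤-trans (p⊆q⇒∣p∣≤∣q∣ (∩-mono-⊆ {p = S ∩ span C} ⊆-refl (p∩q⊆q S (cover F))))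
                                (≤-reflexive (apart-disjoint {S} {C} spS apartC)))

  cover-─ : ∀ {P : Subset n → Set} {F} (p : Any P F) →
            cover F ≡ span (Any.lookup p) ∪ cover (F Any.─ p)
  cover-─ (Any.here _) = refl
  cover-─ {F = C ∷ F} (Any.there p) = begin
    span C ∪ cover F           ≡⟨ cong (span C ∪_) (cover-─ p) ⟩
    span C ∪ (span D ∪ R)      ≡⟨ ∪-assoc (span C) (span D) R ⟨
    (span C ∪ span D) ∪ R      ≡⟨ cong (_∪ R) (∪-comm (span C) (span D)) ⟩
    (span D ∪ span C) ∪ R      ≡⟨ ∪-assoc (span D) (span C) R ⟩
    span D ∪ (span C ∪ R)      ∎
    where
    open ≡-Reasoning
    D = Any.lookup p
    R = cover (F Any.─ p)

  Apart? : ∀ C D → Dec (Apart C D)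
  Apart? C D = k * ∣ C ∩ D ∣ <? ℓ

  insert : ∀ {S} → IsSparse S → ∀ C F → Critical S C → All (Critical S) F → AllPairs Apart F →
           Acc _<_ (length F) →
           ∃ λ F′ → All (Critical S) F′ × AllPairs Apart F′ × span C ∪ cover F ⊆ cover F′
  insert {S} sparse C F crC crF apartF (acc rec) with all? (Apart? C) F
  ... | yes apartC = C ∷ F , crC ∷ crF , apartC ∷ apartF , ⊆-refl
  ... | no ¬apartC =
    let F′ , crF′ , apartF′ , C∪D∪R⊆F′ = insert {S} sparse (C ∪ D) (F Any.─ p)
          (critical-∪ {S} sparse crC crD ¬apartCD) (─⁺ p crF) (AllPairs-─ p apartF) (rec (≤-reflexive (length-─≡ p)))
    in F′ , crF′ , apartF′ , ⊆-trans merged C∪D∪R⊆F′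
    where
    p = ¬All⇒Any¬ (Apart? C) F ¬apartC
    D = Any.lookup p
    R = cover (F Any.─ p)
    crD = proj₁ (lookupAny crF p)
    ¬apartCD = proj₂ (lookupAny crF p)
    merged : span C ∪ cover F ⊆ span (C ∪ D) ∪ R
    merged = ⊆-trans (⊆-reflexive (trans (cong (span C ∪_) (cover-─ p)) (sym (∪-assoc (span C) (span D) R))))
                     (∪-mono-⊆ (span-∪ C D) ⊆-refl)

  separate : ∀ {S} → IsSparse S → ∀ F → All (Critical S) F →
             ∃ λ F′ → All (Critical S) F′ × AllPairs Apart F′ × cover F ⊆ cover F′
  separate sparse []      []          = [] , [] , [] , ⊆-refl
  separate {S} sparse (C ∷ F) (crC ∷ crF) =
    let F₁ , crF₁ , apartF₁ , F⊆F₁ = separate {S} sparse F crF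
        F₂ , crF₂ , apartF₂ , C∪F₁⊆F₂ = insert {S} sparse C F₁ crC crF₁ apartF₁ (<-wellFounded (length F₁))
    in F₂ , crF₂ , apartF₂ , ⊆-trans (∪-mono-⊆ ⊆-refl F⊆F₁) C∪F₁⊆F₂

  covered⇒∣B∣≤∣S∣ : ∀ {S B F} → IsSparse S → IsSparse B → All (Critical S) F → AllPairs Apart F →
                    (∀ y → y ∈ B → y ∉ S → y ∈ cover F) → ∣ B ∣ ≤ ∣ S ∣
  covered⇒∣B∣≤∣S∣ {S} {B} {F} spS spB crF apartF covered = begin
    ∣ B ∣                             ≡⟨ ∣p∣≡∣p∩q∣+∣p─q∣ B (cover F) ⟩
    ∣ B ∩ cover F ∣ + ∣ B ─ cover F ∣ ≤⟨ +-mono-≤ (∣B∩cover∣≤∣S∩cover∣ {S} {B} spS spB crF apartF)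
                                                  (p⊆q⇒∣p∣≤∣q∣ uncovered) ⟩
    ∣ S ∩ cover F ∣ + ∣ S ─ cover F ∣ ≡⟨ ∣p∣≡∣p∩q∣+∣p─q∣ S (cover F) ⟨
    ∣ S ∣                             ∎
    where
    open ≤-Reasoning
    uncovered : B ─ cover F ⊆ S ─ cover F
    uncovered {y} y∈ with y ∈? S
    ... | yes y∈S = x∈p∧x∉q⇒x∈p─q y∈S (x∈p─q⇒x∉q B (cover F) y∈)
    ... | no  y∉S = contradiction (covered y (p─q⊆p B (cover F) y∈) y∉S) (x∈p─q⇒x∉q B (cover F) y∈)

  IsSparse? : ∀ S → Dec (IsSparse S)
  IsSparse? S with anySubset? (λ V → bound V <? edges S V)
  ... | yes (V , violated) = no λ sparse → <⇒≱ violated (sparse V)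
  ... | no  ¬violated      = yes λ V → ≮⇒≥ λ violated → ¬violated (V , violated)

  ¬sparse⇒violated : ∀ {S} → ¬ IsSparse S → ∃ λ V → bound V < edges S V
  ¬sparse⇒violated {S} ¬sparse with anySubset? (λ V → bound V <? edges S V)
  ... | yes violation  = violation
  ... | no  ¬violation = contradiction (λ V → ≮⇒≥ λ violated → ¬violation (V , violated)) ¬sparse

  edges-∪⁅⁆ : ∀ S V y → edges (S ∪ ⁅ y ⁆) V ≤ edges S V + ∣ span V ∩ ⁅ y ⁆ ∣
  edges-∪⁅⁆ S V y = begin
    ∣ (S ∪ ⁅ y ⁆) ∩ span V ∣                 ≡⟨ cong ∣_∣ (∩-distribʳ-∪ (span V) S ⁅ y ⁆) ⟩
    ∣ (S ∩ span V) ∪ (⁅ y ⁆ ∩ span V) ∣      ≤⟨ ∣p∪q∣≤∣p∣+∣q∣ (S ∩ span V) (⁅ y ⁆ ∩ span V) ⟩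
    edges S V + ∣ ⁅ y ⁆ ∩ span V ∣           ≡⟨ cong (λ X → edges S V + ∣ X ∣) (∩-comm ⁅ y ⁆ (span V)) ⟩
    edges S V + ∣ span V ∩ ⁅ y ⁆ ∣           ∎
    where open ≤-Reasoning

  violated⇒critical : ∀ {S V y} → IsSparse S → bound V < edges (S ∪ ⁅ y ⁆) V →
                      Critical S V × y ∈ span V
  violated⇒critical {S} {V} {y} sparse violated with y ∈? span V
  ... | yes y∈V = ≤-pred (≤-trans violated (≤-trans (edges-∪⁅⁆ S V y) (≤-reflexive one-more))) , y∈V
    where
    one-more : edges S V + ∣ span V ∩ ⁅ y ⁆ ∣ ≡ suc (edges S V)
    one-more = trans (cong (edges S V +_) (∣p∩⁅x⁆∣≡1 (span V) y∈V)) (+-comm (edges S V) 1)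
  ... | no y∉V = contradiction (sparse V) (<⇒≱ (≤-trans violated (≤-trans (edges-∪⁅⁆ S V y)
                  (≤-reflexive (trans (cong (edges S V +_) (∣p∩⁅x⁆∣≡0 (span V) y∉V)) (+-identityʳ _))))))

  critical-⊥ : ∀ S → Critical S ⊥
  critical-⊥ S = ≤-trans (≤-reflexive bound⊥≡0) z≤n
    where
    bound⊥≡0 : bound ⊥ ≡ 0
    bound⊥≡0 = trans (cong (λ c → k * c ∸ ℓ) (∣⊥∣≡0 n)) (trans (cong (_∸ ℓ) (*-zeroʳ k)) (0∸n≡0 ℓ))

  sparse-augment : ∀ {S B} → IsSparse S → IsSparse B → ∣ S ∣ < ∣ B ∣ →
                   ∃[ y ] y ∈ B × y ∉ S × IsSparse (S ∪ ⁅ y ⁆)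
  sparse-augment {S} {B} spS spB ∣S∣<∣B∣
    with any? (λ y → y ∈? B ×-dec ¬? (y ∈? S) ×-dec IsSparse? (S ∪ ⁅ y ⁆))
  ... | yes augmentation = augmentation
  ... | no ¬augmentation = contradiction ∣B∣≤∣S∣ (<⇒≱ ∣S∣<∣B∣)
    where
    blocker : ∀ y → ∃ λ V → Critical S V × (y ∈ B → y ∉ S → y ∈ span V)
    -- ⊥ is trivially critical and stands in for the y that need no cover.
    blocker y with y ∈? B | y ∈? S
    ... | no  y∉B | _       = ⊥ , critical-⊥ S , λ y∈B _ → contradiction y∈B y∉B
    ... | yes _   | yes y∈S = ⊥ , critical-⊥ S , λ _ y∉S → contradiction y∈S y∉S
    ... | yes y∈B | no  y∉S =
      let V , violated = ¬sparse⇒violated {S ∪ ⁅ y ⁆} λ sparse → ¬augmentation (y , y∈B , y∉S , sparse)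
          crV , y∈V = violated⇒critical {S} spS violated
      in V , crV , λ _ _ → y∈V
    F₀ : List (Subset n)
    F₀ = L.map (proj₁ ∘ blocker) (allFin N)
    F₀-covers : ∀ y → y ∈ B → y ∉ S → y ∈ cover F₀
    F₀-covers y y∈B y∉S =
      span⊆cover (∈-map⁺ (proj₁ ∘ blocker) (∈-allFin y)) (proj₂ (proj₂ (blocker y)) y∈B y∉S)
    ∣B∣≤∣S∣ : ∣ B ∣ ≤ ∣ S ∣
    ∣B∣≤∣S∣ =
      let F , crF , apartF , F₀⊆F = separate {S} spS F₀ (Allₚ.map⁺ (All.universal (proj₁ ∘ proj₂ ∘ blocker) (allFin N)))
      in covered⇒∣B∣≤∣S∣ {S} {B} spS spB crF apartF λ y y∈B y∉S → F₀⊆F (F₀-covers y y∈B y∉S)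

module _ (n k ℓ : ℕ) where
  open CountMatroid (ends n k ℓ) k ℓ

  induced≡∩span : ∀ B V → induced n k ℓ B V ≡ B ∩ span V
  induced≡∩span B V = begin
    induced n k ℓ B V
      ≡⟨ tabulate-cong (λ i → cong₂ _∧_ (trans (isYes≗does (i ∈? B)) (does-∈?≡lookup i B))
                                        (trans (⌊⌋≡induces (ends n k ℓ i))
                                               (sym (lookup∘tabulate (induces V ∘ ends n k ℓ) i)))) ⟩
    tabulate (λ i → V.lookup B i ∧ V.lookup (span V) i)
      ≡⟨ tabulate-cong (λ i → lookup-zipWith _∧_ i B (span V)) ⟨
    tabulate (V.lookup (B ∩ span V))
      ≡⟨ tabulate∘lookup (B ∩ span V) ⟩
    B ∩ span V
      ∎
    where
    open ≡-Reasoning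
    ⌊⌋≡induces : ∀ e → ⌊ proj₁ e ∈? V ⌋ ∧ ⌊ proj₂ e ∈? V ⌋ ≡ induces V e
    ⌊⌋≡induces e = cong₂ _∧_ (isYes≗does (proj₁ e ∈? V)) (isYes≗does (proj₂ e ∈? V))

  Sparse⇒IsSparse : ∀ {B} → Sparse n k ℓ B → IsSparse B
  Sparse⇒IsSparse {B} sparse V = subst (λ X → ∣ X ∣ ≤ bound V) (induced≡∩span B V) (sparse V)

  IsSparse⇒Sparse : ∀ {B} → IsSparse B → Sparse n k ℓ B
  IsSparse⇒Sparse {B} sparse V = subst (λ X → ∣ X ∣ ≤ bound V) (sym (induced≡∩span B V)) (sparse V)

  tight-exchange : ∀ B₁ B₂ → Tight n k ℓ B₁ → Tight n k ℓ B₂ → ∀ x → x ∈ B₁ → x ∉ B₂ →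
                   ∃[ y ] (y ∈ B₂ × y ∉ B₁ × Tight n k ℓ ((B₁ - x) ∪ ⁅ y ⁆))
  tight-exchange B₁ B₂ (sp₁ , size₁) (sp₂ , size₂) x x∈B₁ x∉B₂ =
    let y , y∈B₂ , y∉B₁-x , sparse = sparse-augment {B₁ - x} {B₂} spB₁-x (Sparse⇒IsSparse sp₂) ∣B₁-x∣<∣B₂∣
    in y , y∈B₂ , y∉B₁ y∈B₂ y∉B₁-x , IsSparse⇒Sparse sparse , size y∉B₁-x
    where
    spB₁-x : IsSparse (B₁ - x)
    spB₁-x = sparse-⊆ {B₁ - x} {B₁} (p─q⊆p B₁ ⁅ x ⁆) (Sparse⇒IsSparse sp₁)
    ∣B₁∣≡1+∣B₁-x∣ : ∣ B₁ ∣ ≡ suc ∣ B₁ - x ∣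
    ∣B₁∣≡1+∣B₁-x∣ = ∣p∣≡1+∣p-x∣ B₁ x∈B₁
    ∣B₁-x∣<∣B₂∣ : ∣ B₁ - x ∣ < ∣ B₂ ∣
    ∣B₁-x∣<∣B₂∣ = ≤-reflexive (trans (sym ∣B₁∣≡1+∣B₁-x∣) (+-cancelʳ-≡ ℓ _ _ (trans size₁ (sym size₂))))
    y∉B₁ : ∀ {y} → y ∈ B₂ → y ∉ B₁ - x → y ∉ B₁
    y∉B₁ y∈B₂ y∉B₁-x y∈B₁ = y∉B₁-x (x∈p∧x≢y⇒x∈p-y y∈B₁ λ { refl → x∉B₂ y∈B₂ })
    size : ∀ {y} → y ∉ B₁ - x → ∣ (B₁ - x) ∪ ⁅ y ⁆ ∣ + ℓ ≡ k * n
    size y∉ = trans (cong (_+ ℓ) (trans (∣p∪⁅x⁆∣≡1+∣p∣ (B₁ - x) y∉) (sym ∣B₁∣≡1+∣B₁-x∣))) size₁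

-- Sub-multisets of the edges of K

module Multiset {A : Set} (_≟_ : DecidableEquality A) where
  open DecMembership _≟_ using () renaming (_∈?_ to _∈ₗ?_)

  multiplicity : A → List A → ℕ
  multiplicity a = count (λ x → does (x ≟ a))

  multiplicity-∉ : ∀ {a xs} → a ∉ₗ xs → multiplicity a xs ≡ 0
  multiplicity-∉ {a} {[]}     a∉ = refl
  multiplicity-∉ {a} {x ∷ xs} a∉ with x ≟ a
  ... | yes refl = contradiction (Any.here refl) a∉
  ... | no  _    = multiplicity-∉ (a∉ ∘ Any.there)

  -- Scan E, keeping a position exactly when its element still occurs in what is left of L.
  realise : ∀ E L → (∀ a → multiplicity a L ≤ multiplicity a E) →
            ∃ λ (B : Subset (length E)) →
              ∣ B ∣ ≡ length L × (∀ p → ∣ B ∩ tabulate (p ∘ L.lookup E) ∣ ≡ count p L)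
  realise []      []      _   = [] , refl , λ _ → refl
  realise []      (a ∷ L) L⊆E with a ≟ a | L⊆E a
  ... | yes _   | ()
  ... | no  a≢a | _ = contradiction refl a≢a
  realise (e ∷ E) L L⊆E with e ∈ₗ? L
  ... | yes e∈L =
    let B , ∣B∣≡ , counts = realise E (L Any.─ e∈L) λ a →
          count-∷-cancel _ e (L Any.─ e∈L) E (subst (_≤ multiplicity a (e ∷ E)) (count-─ _ e∈L) (L⊆E a))
    in inside ∷ B , trans (cong suc ∣B∣≡) (length-─≡ e∈L) ,
       λ p → trans (count-∷ p {B ∩ tabulate (p ∘ L.lookup E)} {L Any.─ e∈L} (counts p)) (sym (count-─ p e∈L))
    where
    count-∷ : ∀ p {X} {R} → ∣ X ∣ ≡ count p R → ∣ p e ∷ X ∣ ≡ count p (e ∷ R)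
    count-∷ p ∣X∣≡ with p e
    ... | true  = cong suc ∣X∣≡
    ... | false = ∣X∣≡
  ... | no  e∉L =
    let B , ∣B∣≡ , counts = realise E L λ a → L⊆E′ a (L⊆E a)
    in outside ∷ B , ∣B∣≡ , counts
    where
    L⊆E′ : ∀ a → multiplicity a L ≤ multiplicity a (e ∷ E) → multiplicity a L ≤ multiplicity a E
    L⊆E′ a le with e ≟ a
    ... | yes refl = ≤-trans (≤-reflexive (multiplicity-∉ e∉L)) z≤n
    ... | no  _    = le

-- Unlike Data.Product.Properties.≡-dec, its does computes componentwise on constructor forms.
_≟ₑ_ : ∀ {n} → DecidableEquality (Edge n)
(u , v) ≟ₑ (u′ , v′) = map′ (uncurry (cong₂ _,_)) ,-injective (u F.≟ u′ ×-dec v F.≟ v′)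

open module EdgeMultiset {n} = Multiset (_≟ₑ_ {n}) using (multiplicity; realise)

capacity : ∀ {n} → ℕ → ℕ → Fin n → Fin n → ℕ
capacity k ℓ u v = if does (u F.≟ v) then k ∸ ℓ else if does (u F.<? v) then 2 * k ∸ ℓ else 0

module _ (n k ℓ : ℕ) where

  private
    row : Fin n → Fin n → List (Edge n)
    row u w = if ⌊ u F.<? w ⌋ then replicate (2 * k ∸ ℓ) (u , w) else []
    loopList pairList : List (Edge n)
    loopList = concatMap (λ w → replicate (k ∸ ℓ) (w , w)) (allFin n)
    pairList = concatMap (λ u → concatMap (row u) (allFin n)) (allFin n)

    multiplicity-replicate : ∀ r (e : Edge n) → multiplicity e (replicate r e) ≡ r
    multiplicity-replicate r e = trans (count-replicate (λ x → does (x ≟ₑ e)) r e)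
                                       (cong (if_then r else 0) (dec-true (e ≟ₑ e) refl))

  capacity≤multiplicity : ∀ (u v : Fin n) → capacity k ℓ u v ≤ multiplicity (u , v) (KEdges n k ℓ)
  -- In the goal, does (u F.<? v) has already computed to a comparison of toℕ u and toℕ v,
  -- which `with` does not abstract; so it is rewritten by hand.
  capacity≤multiplicity u v with u F.≟ v | u F.<? v
  ... | yes refl | _       = begin
    k ∸ ℓ                                             ≡⟨ multiplicity-replicate (k ∸ ℓ) (u , u) ⟨
    multiplicity (u , u) (replicate (k ∸ ℓ) (u , u))  ≤⟨ count-concatMap p loops (∈-allFin u) ⟩
    multiplicity (u , u) loopList                     ≤⟨ count-++ˡ p loopList pairList ⟩
    multiplicity (u , u) (KEdges n k ℓ)               ∎
    where
    open ≤-Reasoning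
    p = λ x → does (x ≟ₑ (u , u))
    loops = λ w → replicate (k ∸ ℓ) (w , w)
  ... | no _     | yes u<v =
    ≤-trans (≤-reflexive (cong (if_then 2 * k ∸ ℓ else 0) (dec-true (u F.<? v) u<v))) (begin
      2 * k ∸ ℓ                                        ≡⟨ multiplicity-replicate (2 * k ∸ ℓ) (u , v) ⟨
      multiplicity (u , v) parallel                    ≡⟨ cong (λ b → multiplicity (u , v) (if b then parallel else []))
                                                               ⌊u<v⌋ ⟨
      multiplicity (u , v) (row u v)                   ≤⟨ count-concatMap p (row u) (∈-allFin v) ⟩
      multiplicity (u , v) (concatMap (row u) (allFin n))
                                                       ≤⟨ count-concatMap p (λ w → concatMap (row w) (allFin n)) (∈-allFin u) ⟩
      multiplicity (u , v) pairList                    ≤⟨ count-++ʳ p loopList pairList ⟩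
      multiplicity (u , v) (KEdges n k ℓ)              ∎)
    where
    open ≤-Reasoning
    p = λ x → does (x ≟ₑ (u , v))
    parallel = replicate (2 * k ∸ ℓ) (u , v)
    ⌊u<v⌋ : ⌊ u F.<? v ⌋ ≡ true
    ⌊u<v⌋ = trans (isYes≗does (u F.<? v)) (dec-true (u F.<? v) u<v)
  ... | no _     | no u≮v  =
    ≤-trans (≤-reflexive (cong (if_then 2 * k ∸ ℓ else 0) (dec-false (u F.<? v) u≮v))) z≤n

-- Adding a vertex

open module VertexMultiset {n} = Multiset (F._≟_ {n}) using () renaming (multiplicity to multiplicityᵥ)

module _ {n : ℕ} where

  star : Fin n → Edge (suc n)
  star v = zero , suc v

  shift : Edge n → Edge (suc n)
  shift = Product.map suc suc

  -- The new vertex is zero, so each new edge (zero , suc v) is oriented as in KEdges.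
  extend : ℕ → List (Fin n) → List (Edge n) → List (Edge (suc n))
  extend a N L = replicate a (zero , zero) ++ L.map star N ++ L.map shift L

  degreeIn : Subset n → List (Fin n) → ℕ
  degreeIn T = count (λ v → does (v ∈? T))

  count-extend-parts : ∀ p a N L → count p (extend a N L) ≡
                       count p (replicate a (zero , zero)) + (count (p ∘ star) N + count (p ∘ shift) L)
  count-extend-parts p a N L = begin
    count p (extend a N L)
      ≡⟨ count-++ p (replicate a (zero , zero)) (L.map star N ++ L.map shift L) ⟩
    count p (replicate a (zero , zero)) + count p (L.map star N ++ L.map shift L)
      ≡⟨ cong (count p (replicate a (zero , zero)) +_) (count-++ p (L.map star N) (L.map shift L)) ⟩
    count p (replicate a (zero , zero)) + (count p (L.map star N) + count p (L.map shift L))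
      ≡⟨ cong (λ c → count p (replicate a (zero , zero)) + c) (cong₂ _+_ (count-map p star N) (count-map p shift L)) ⟩
    count p (replicate a (zero , zero)) + (count (p ∘ star) N + count (p ∘ shift) L)
      ∎
    where open ≡-Reasoning

  count-extend : ∀ b T a N L → count (induces (b ∷ T)) (extend a N L) ≡
                 (if b then a + degreeIn T N else 0) + count (induces T) L
  count-extend true  T a N L = trans (count-extend-parts (induces (inside ∷ T)) a N L)
    (trans (cong (_+ (degreeIn T N + count (induces T) L)) (count-replicate (induces (inside ∷ T)) a (zero , zero)))
           (sym (+-assoc a (degreeIn T N) (count (induces T) L))))
  count-extend false T a N L = trans (count-extend-parts (induces (outside ∷ T)) a N L)
    (cong₂ _+_ (count-replicate (induces (outside ∷ T)) a (zero , zero))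
               (cong (_+ count (induces T) L) (count-false N)))

length-extend : ∀ {n} a N (L : List (Edge n)) → length (extend a N L) ≡ a + (length N + length L)
length-extend a N L = trans (length-++ (replicate a (zero , zero)))
  (cong₂ _+_ (length-replicate a {zero , zero})
             (trans (length-++ (L.map star N)) (cong₂ _+_ (length-map star N) (length-map shift L))))

WithinK : ∀ {n} → ℕ → ℕ → List (Edge n) → Set
WithinK k ℓ L = ∀ u v → multiplicity (u , v) L ≤ capacity k ℓ u v

extend-withinK : ∀ {n k ℓ a N} {L : List (Edge n)} → a ≤ k ∸ ℓ → (∀ w → multiplicityᵥ w N ≤ 2 * k ∸ ℓ) →
                 WithinK k ℓ L → WithinK k ℓ (extend a N L)
extend-withinK {n} {k} {ℓ} {a} {N} {L} a≤ N≤ L≤ u v =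
  ≤-trans (≤-reflexive (count-extend-parts (is (u , v)) a N L)) (parts u v)
  where
  is : Edge (suc n) → Edge (suc n) → Bool
  is e x = does (x ≟ₑ e)
  parts : ∀ u v → count (is (u , v)) (replicate a (zero , zero)) +
                  (count (is (u , v) ∘ star) N + count (is (u , v) ∘ shift) L) ≤ capacity k ℓ u v
  parts zero zero = begin
    count (is (zero , zero)) (replicate a (zero , zero)) + (count (λ _ → false) N + count (λ _ → false) L)
      ≡⟨ cong₂ _+_ (count-replicate (is (zero , zero)) a (zero , zero))
                   (cong₂ _+_ (count-false N) (count-false L)) ⟩
    a + 0  ≡⟨ +-identityʳ a ⟩
    a      ≤⟨ a≤ ⟩
    k ∸ ℓ  ∎
    where open ≤-Reasoning
  parts zero (suc v) = begin
    count (is (zero , suc v)) (replicate a (zero , zero)) + (multiplicityᵥ v N + count (λ _ → false) L)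
      ≡⟨ cong₂ _+_ (count-replicate (is (zero , suc v)) a (zero , zero))
                   (cong (multiplicityᵥ v N +_) (count-false L)) ⟩
    multiplicityᵥ v N + 0  ≡⟨ +-identityʳ _ ⟩
    multiplicityᵥ v N      ≤⟨ N≤ v ⟩
    2 * k ∸ ℓ              ∎
    where open ≤-Reasoning
  parts (suc u) zero = ≤-reflexive (cong₂ _+_ (count-replicate (is (suc u , zero)) a (zero , zero))
    (cong₂ _+_ (count-false N) (trans (count-≗ (λ x → ∧-zeroʳ (does (proj₁ x F.≟ u))) L) (count-false L))))
  parts (suc u) (suc v) = begin
    count (is (suc u , suc v)) (replicate a (zero , zero)) + (count (λ _ → false) N + multiplicity (u , v) L)
      ≡⟨ cong₂ _+_ (count-replicate (is (suc u , suc v)) a (zero , zero))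
                   (cong (_+ multiplicity (u , v) L) (count-false N)) ⟩
    multiplicity (u , v) L  ≤⟨ L≤ u v ⟩
    capacity k ℓ u v        ∎
    where open ≤-Reasoning

IsSparseGraph : ∀ {n} → ℕ → ℕ → List (Edge n) → Set
IsSparseGraph k ℓ L = ∀ T → count (induces T) L ≤ k * ∣ T ∣ ∸ ℓ

record TightIn (n k ℓ : ℕ) : Set where
  field
    graph   : List (Edge n)
    sparse  : IsSparseGraph k ℓ graph
    withinK : WithinK k ℓ graph
    size    : length graph + ℓ ≡ k * n

TightIn⇒Tight : ∀ {n k ℓ} → TightIn n k ℓ → ∃[ B ] Tight n k ℓ B
TightIn⇒Tight {n} {k} {ℓ} tight =
  let B , ∣B∣≡ , counts = realise (KEdges n k ℓ) graph
        (λ e → ≤-trans (withinK (proj₁ e) (proj₂ e)) (capacity≤multiplicity n k ℓ (proj₁ e) (proj₂ e)))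
  in B , IsSparse⇒Sparse n k ℓ (λ V → ≤-trans (≤-reflexive (counts (induces V))) (sparse V)) ,
     trans (cong (_+ ℓ) ∣B∣≡) size
  where open TightIn tight

copies : ℕ → (j : ℕ) → List (Fin j)
copies r zero    = []
copies r (suc j) = replicate r zero ++ L.map suc (copies r j)

degreeIn-copies : ∀ r {j} (T : Subset j) → degreeIn T (copies r j) ≡ r * ∣ T ∣
degreeIn-copies r []      = sym (*-zeroʳ r)
degreeIn-copies r {suc j} (b ∷ T) =
  trans (count-++ _ (replicate r zero) (L.map suc (copies r j)))
        (trans (cong₂ _+_ (count-replicate _ r zero) (trans (count-map _ F.suc (copies r j)) (degreeIn-copies r T)))
               (head b))
  where
  head : ∀ b → (if does (zero ∈? b ∷ T) then r else 0) + r * ∣ T ∣ ≡ r * ∣ b ∷ T ∣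
  head inside  = sym (*-suc r ∣ T ∣)
  head outside = refl

multiplicity-copies : ∀ r {j} (w : Fin j) → multiplicityᵥ w (copies r j) ≡ r
multiplicity-copies r {suc j} zero    = begin
  count _ (replicate r zero ++ L.map suc (copies r j))  ≡⟨ count-++ _ (replicate r zero) (L.map suc (copies r j)) ⟩
  count _ (replicate r zero) + count _ (L.map suc (copies r j))
    ≡⟨ cong₂ _+_ (count-replicate _ r zero) (trans (count-map _ F.suc (copies r j)) (count-false (copies r j))) ⟩
  r + 0                                                ≡⟨ +-identityʳ r ⟩
  r                                                    ∎
  where open ≡-Reasoning
multiplicity-copies r {suc j} (suc w) =
  trans (count-++ _ (replicate r zero) (L.map suc (copies r j)))
        (cong₂ _+_ (count-replicate _ r zero) (trans (count-map _ F.suc (copies r j)) (multiplicity-copies r w)))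

length-copies : ∀ r j → length (copies r j) ≡ j * r
length-copies r zero    = refl
length-copies r (suc j) = trans (length-++ (replicate r zero))
  (cong₂ _+_ (length-replicate r {zero}) (trans (length-map F.suc (copies r j)) (length-copies r j)))

spread : ℕ → (j : ℕ) → ℕ → List (Fin j)
spread r j X = take X (copies r j)

degreeIn-spread≤total : ∀ r {j} X (T : Subset j) → degreeIn T (spread r j X) ≤ X
degreeIn-spread≤total r {j} X T = ≤-trans (count≤length _ (spread r j X))
  (≤-trans (≤-reflexive (length-take X (copies r j))) (m⊓n≤m X _))

degreeIn-spread≤copies : ∀ r {j} X (T : Subset j) → degreeIn T (spread r j X) ≤ r * ∣ T ∣
degreeIn-spread≤copies r {j} X T = ≤-trans (count-take _ X (copies r j)) (≤-reflexive (degreeIn-copies r T))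

multiplicity-spread : ∀ r {j} X (w : Fin j) → multiplicityᵥ w (spread r j X) ≤ r
multiplicity-spread r {j} X w = ≤-trans (count-take _ X (copies r j)) (≤-reflexive (multiplicity-copies r w))

length-spread : ∀ r j {X} → X ≤ j * r → length (spread r j X) ≡ X
length-spread r j {X} X≤ =
  trans (length-take X (copies r j)) (m≤n⇒m⊓n≡m (≤-trans X≤ (≤-reflexive (sym (length-copies r j)))))

-- Tight subgraphs of K

[1+n]C2≡n+nC2 : ∀ n → suc n choose 2 ≡ n + n choose 2
[1+n]C2≡n+nC2 n = trans (sym (nCk+nC[k+1]≡[n+1]C[k+1] n 1)) (cong (_+ n choose 2) (nC1≡n n))

2*[1+n]C2≡[1+n]*n : ∀ n → 2 * (suc n choose 2) ≡ suc n * n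
2*[1+n]C2≡[1+n]*n zero    = refl
2*[1+n]C2≡[1+n]*n (suc n) = begin
  2 * (suc (suc n) choose 2)        ≡⟨ cong (2 *_) ([1+n]C2≡n+nC2 (suc n)) ⟩
  2 * (suc n + suc n choose 2)      ≡⟨ *-distribˡ-+ 2 (suc n) (suc n choose 2) ⟩
  2 * suc n + 2 * (suc n choose 2)  ≡⟨ cong (2 * suc n +_) (2*[1+n]C2≡[1+n]*n n) ⟩
  2 * suc n + suc n * n             ≡⟨ solve 1 (λ n → con 2 :* (con 1 :+ n) :+ (con 1 :+ n) :* n
                                                 := (con 2 :+ n) :* (con 1 :+ n)) refl n ⟩
  suc (suc n) * suc n               ∎
  where
  open ≡-Reasoning
  open +-*-Solver

n<2*n : ∀ {n} → 0 < n → n < 2 * n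
n<2*n {n} 0<n = ≤-trans (m<m+n n 0<n) (≤-reflexive (cong (n +_) (sym (+-identityʳ n))))

ceiling-quotient : ∀ a d .{{_ : NonZero d}} → 1 ≤ a → ∃ λ q → d * q < a × a ≤ d * suc q
ceiling-quotient (suc a) d _ = a / d , s≤s d*q≤a , a<d*[1+q]
  where
  d*q≤a : d * (a / d) ≤ a
  d*q≤a = ≤-trans (≤-reflexive (*-comm d (a / d))) (m/n*n≤m a d)
  a<d*[1+q] : a < d * suc (a / d)
  a<d*[1+q] = begin-strict
    a                       ≡⟨ m≡m%n+[m/n]*n a d ⟩
    a % d + a / d * d       <⟨ +-monoˡ-< (a / d * d) (m%n<n a d) ⟩
    d + a / d * d           ≡⟨ *-comm (suc (a / d)) d ⟩
    d * suc (a / d)         ∎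
    where open ≤-Reasoning

module Construction (k ℓ : ℕ) (ℓ<2k : ℓ < 2 * k) where

  m : ℕ
  m = 2 * k ∸ ℓ

  ℓ+m≡2k : ℓ + m ≡ 2 * k
  ℓ+m≡2k = m+[n∸m]≡n (<⇒≤ ℓ<2k)

  -- If k t < ℓ then ℓ < 2k forces t ≤ 1, and a single old vertex takes at most m edges.
  add-vertex-bound : ∀ {s t E} → s ≤ k → s ≤ m * t → E ≤ k * t ∸ ℓ → s + E ≤ k * suc t ∸ ℓ
  add-vertex-bound {s} {t} {E} s≤k s≤mt E≤ with ℓ ≤? k * t
  ... | yes ℓ≤kt = begin
    s + E            ≤⟨ +-mono-≤ s≤k E≤ ⟩
    k + (k * t ∸ ℓ)  ≡⟨ +-∸-assoc k ℓ≤kt ⟨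
    k + k * t ∸ ℓ    ≡⟨ cong (_∸ ℓ) (*-suc k t) ⟨
    k * suc t ∸ ℓ    ∎
    where open ≤-Reasoning
  ... | no ℓ≰kt = begin
    s + E            ≡⟨ cong (s +_) (n≤0⇒n≡0 (≤-trans E≤ (≤-reflexive (m≤n⇒m∸n≡0 (<⇒≤ (≰⇒> ℓ≰kt)))))) ⟩
    s + 0            ≡⟨ +-identityʳ s ⟩
    s                ≤⟨ s≤mt ⟩
    m * t            ≤⟨ few (≰⇒> ℓ≰kt) ⟩
    k * suc t ∸ ℓ    ∎
    where
    open ≤-Reasoning
    few : ∀ {t} → k * t < ℓ → m * t ≤ k * suc t ∸ ℓ
    few {zero}        _    = ≤-trans (≤-reflexive (*-zeroʳ m)) z≤n
    few {suc zero}    _    = ≤-reflexive (trans (*-identityʳ m) (cong (_∸ ℓ) (*-comm 2 k)))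
    few {suc (suc t)} kt<ℓ = contradiction (≤-trans (<⇒≤ ℓ<2k) (≤-trans (≤-reflexive (*-comm 2 k))
                                                     (*-monoʳ-≤ k (s≤s (s≤s z≤n))))) (<⇒≱ kt<ℓ)

  extend-sparse : ∀ {j} {N : List (Fin j)} {L} → IsSparseGraph k ℓ L → (∀ T → degreeIn T N ≤ k) →
                  (∀ T → degreeIn T N ≤ m * ∣ T ∣) → IsSparseGraph k ℓ (extend 0 N L)
  extend-sparse {N = N} {L} sparse _  _  (outside ∷ T) =
    ≤-trans (≤-reflexive (count-extend outside T 0 N L)) (sparse T)
  extend-sparse {N = N} {L} sparse ≤k ≤m (inside  ∷ T) =
    ≤-trans (≤-reflexive (count-extend inside T 0 N L)) (add-vertex-bound (≤k T) (≤m T) (sparse T))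

  grow : ∀ {j} → k ≤ j * m → TightIn j k ℓ → TightIn (suc j) k ℓ
  grow {j} k≤jm tight = record
    { graph   = extend 0 N graph
    ; sparse  = extend-sparse {N = N} {graph} sparse (degreeIn-spread≤total m k) (degreeIn-spread≤copies m k)
    ; withinK = extend-withinK {k = k} {ℓ} {N = N} {graph} z≤n (multiplicity-spread m k) withinK
    ; size    = begin
        length (extend 0 N graph) + ℓ    ≡⟨ cong (_+ ℓ) (length-extend 0 N graph) ⟩
        length N + length graph + ℓ      ≡⟨ cong (λ d → d + length graph + ℓ) (length-spread m j k≤jm) ⟩
        k + length graph + ℓ             ≡⟨ +-assoc k (length graph) ℓ ⟩
        k + (length graph + ℓ)           ≡⟨ cong (k +_) size ⟩
        k + k * j                        ≡⟨ *-suc k j ⟨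
        k * suc j                        ∎
    }
    where
    open TightIn tight
    open ≡-Reasoning
    N = spread m j k

  grow-by : ∀ {q} → k ≤ q * m → TightIn q k ℓ → ∀ d → TightIn (d + q) k ℓ
  grow-by k≤qm base zero    = base
  grow-by {q} k≤qm base (suc d) = grow (≤-trans k≤qm (*-monoˡ-≤ m (m≤n+m q d))) (grow-by k≤qm base d)

  grow-from : ∀ {q n} → k ≤ q * m → TightIn q k ℓ → q ≤ n → TightIn n k ℓ
  grow-from {q} {n} k≤qm base q≤n =
    subst (λ n → TightIn n k ℓ) (m∸n+n≡m q≤n) (grow-by k≤qm base (n ∸ q))

  complete : (j : ℕ) → List (Edge j)
  complete zero    = []
  complete (suc j) = extend 0 (copies m j) (complete j)

  m*[1+t]choose2 : ∀ t → m * t + m * (t choose 2) ≡ m * (suc t choose 2)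
  m*[1+t]choose2 t = trans (sym (*-distribˡ-+ m t (t choose 2))) (cong (m *_) (sym ([1+n]C2≡n+nC2 t)))

  count-complete : ∀ {j} (T : Subset j) → count (induces T) (complete j) ≡ m * (∣ T ∣ choose 2)
  count-complete []               = sym (*-zeroʳ m)
  count-complete {suc j} (b ∷ T) = trans (count-extend b T 0 (copies m j) (complete j)) (new-vertex b)
    where
    new-vertex : ∀ b → (if b then degreeIn T (copies m j) else 0) + count (induces T) (complete j) ≡
                       m * (∣ b ∷ T ∣ choose 2)
    new-vertex inside  = trans (cong₂ _+_ (degreeIn-copies m T) (count-complete T)) (m*[1+t]choose2 ∣ T ∣)
    new-vertex outside = count-complete T

  length-complete : ∀ j → length (complete j) ≡ m * (j choose 2)
  length-complete zero    = sym (*-zeroʳ m)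
  length-complete (suc j) = begin
    length (extend 0 (copies m j) (complete j))  ≡⟨ length-extend 0 (copies m j) (complete j) ⟩
    length (copies m j) + length (complete j)    ≡⟨ cong₂ _+_ (trans (length-copies m j) (*-comm j m))
                                                             (length-complete j) ⟩
    m * j + m * (j choose 2)                          ≡⟨ m*[1+t]choose2 j ⟩
    m * (suc j choose 2)                              ∎
    where open ≡-Reasoning

  complete-withinK : ∀ j → WithinK k ℓ (complete j)
  complete-withinK zero    ()
  complete-withinK (suc j) = extend-withinK {k = k} {ℓ} {N = copies m j} {complete j} z≤n
    (λ w → ≤-reflexive (multiplicity-copies m w)) (complete-withinK j)

  -- By count-complete, this says that complete p is (k, ℓ)-sparse.
  CompleteSparse : ℕ → Set
  CompleteSparse p = ∀ t → t ≤ p → m * (t choose 2) ≤ k * t ∸ ℓ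

  2*[m*[2+s]C2+ℓ] : ∀ s → 2 * (m * ((2 + s) choose 2) + ℓ) ≡ s * (m * (3 + s)) + 2 * (2 * k)
  2*[m*[2+s]C2+ℓ] s = begin
    2 * (m * ((2 + s) choose 2) + ℓ)      ≡⟨ solve 3 (λ m c l → con 2 :* (m :* c :+ l) := m :* (con 2 :* c) :+ con 2 :* l)
                                                     refl m ((2 + s) choose 2) ℓ ⟩
    m * (2 * ((2 + s) choose 2)) + 2 * ℓ  ≡⟨ cong (λ c → m * c + 2 * ℓ) (2*[1+n]C2≡[1+n]*n (suc s)) ⟩
    m * ((2 + s) * (1 + s)) + 2 * ℓ       ≡⟨ solve 3 (λ m s l → m :* ((con 2 :+ s) :* (con 1 :+ s)) :+ con 2 :* l
                                                     := s :* (m :* (con 3 :+ s)) :+ con 2 :* (l :+ m)) refl m s ℓ ⟩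
    s * (m * (3 + s)) + 2 * (ℓ + m)       ≡⟨ cong (λ x → s * (m * (3 + s)) + 2 * x) ℓ+m≡2k ⟩
    s * (m * (3 + s)) + 2 * (2 * k)       ∎
    where
    open ≡-Reasoning
    open +-*-Solver

  2*[k*[2+s]] : ∀ s → 2 * (k * (2 + s)) ≡ s * (2 * k) + 2 * (2 * k)
  2*[k*[2+s]] s =
    solve 2 (λ k s → con 2 :* (k :* (con 2 :+ s)) := s :* (con 2 :* k) :+ con 2 :* (con 2 :* k)) refl k s
    where open +-*-Solver

  complete-sparse-at : ∀ s → m * (3 + s) ≤ 2 * k → m * ((2 + s) choose 2) ≤ k * (2 + s) ∸ ℓ
  complete-sparse-at s m[3+s]≤2k = m+n≤o⇒m≤o∸n _ (*-cancelˡ-≤ 2 (begin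
    2 * (m * ((2 + s) choose 2) + ℓ)  ≡⟨ 2*[m*[2+s]C2+ℓ] s ⟩
    s * (m * (3 + s)) + 2 * (2 * k)   ≤⟨ +-monoˡ-≤ _ (*-monoʳ-≤ s m[3+s]≤2k) ⟩
    s * (2 * k) + 2 * (2 * k)         ≡⟨ 2*[k*[2+s]] s ⟨
    2 * (k * (2 + s))                 ∎))
    where open ≤-Reasoning

  complete-dense-at : ∀ s → 2 * k ≤ m * (3 + s) → k * (2 + s) ≤ m * ((2 + s) choose 2) + ℓ
  complete-dense-at s 2k≤m[3+s] = *-cancelˡ-≤ 2 (begin
    2 * (k * (2 + s))                 ≡⟨ 2*[k*[2+s]] s ⟩
    s * (2 * k) + 2 * (2 * k)         ≤⟨ +-monoˡ-≤ _ (*-monoʳ-≤ s 2k≤m[3+s]) ⟩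
    s * (m * (3 + s)) + 2 * (2 * k)   ≡⟨ 2*[m*[2+s]C2+ℓ] s ⟨
    2 * (m * ((2 + s) choose 2) + ℓ)  ∎)
    where open ≤-Reasoning

  complete-sparse : ∀ p → m * suc p ≤ 2 * k → CompleteSparse p
  complete-sparse p _   zero          _   = ≤-trans (≤-reflexive (*-zeroʳ m)) z≤n
  complete-sparse p _   (suc zero)    _   = ≤-trans (≤-reflexive (*-zeroʳ m)) z≤n
  complete-sparse p m[1+p]≤2k (suc (suc s)) t≤p =
    complete-sparse-at s (≤-trans (*-monoʳ-≤ m (s≤s t≤p)) m[1+p]≤2k)

  complete-sparse-1 : CompleteSparse 1
  complete-sparse-1 zero          _               = ≤-trans (≤-reflexive (*-zeroʳ m)) z≤n
  complete-sparse-1 (suc zero)    _               = ≤-trans (≤-reflexive (*-zeroʳ m)) z≤n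
  complete-sparse-1 (suc (suc s)) (s≤s ())

  -- complete p together with a vertex joined by the X edges still missing for tightness.
  module Completion (p : ℕ) (p≥1 : 1 ≤ p) (sparseK : CompleteSparse p)
                    (dense : k * suc p ≤ m * (suc p choose 2) + ℓ) where

    X : ℕ
    X = k * suc p ∸ ℓ ∸ m * (p choose 2)

    N : List (Fin p)
    N = spread m p X

    graph : List (Edge (suc p))
    graph = extend 0 N (complete p)

    X+m*[pC2]≡k*[1+p]∸ℓ : X + m * (p choose 2) ≡ k * suc p ∸ ℓ
    X+m*[pC2]≡k*[1+p]∸ℓ = m∸n+n≡m (≤-trans (sparseK p ≤-refl) (∸-monoˡ-≤ ℓ (*-monoʳ-≤ k (n≤1+n p))))

    X≤p*m : X ≤ p * m
    X≤p*m = m≤n+o⇒m∸n≤o (k * suc p ∸ ℓ) (m * (p choose 2))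
              (m≤n+o⇒m∸n≤o (k * suc p) ℓ (≤-trans dense (≤-reflexive (begin
      m * (suc p choose 2) + ℓ          ≡⟨ cong (_+ ℓ) (m*[1+t]choose2 p) ⟨
      m * p + m * (p choose 2) + ℓ      ≡⟨ solve 4 (λ m p c l → m :* p :+ m :* c :+ l := l :+ (m :* c :+ p :* m))
                                                   refl m p (p choose 2) ℓ ⟩
      ℓ + (m * (p choose 2) + p * m)    ∎))))
      where
      open ≡-Reasoning
      open +-*-Solver

    count-inside : ∀ T → count (induces (inside ∷ T)) graph ≡ degreeIn T N + m * (∣ T ∣ choose 2)
    count-inside T = trans (count-extend inside T 0 N (complete p)) (cong (degreeIn T N +_) (count-complete T))

    graph-sparse : IsSparseGraph k ℓ graph
    graph-sparse (outside ∷ T) =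
      ≤-trans (≤-reflexive (trans (count-extend outside T 0 N (complete p)) (count-complete T)))
              (sparseK ∣ T ∣ (∣p∣≤n T))
    graph-sparse (inside ∷ T) with m≤n⇒m<n∨m≡n (∣p∣≤n T)
    ... | inj₁ t<p = begin
      count (induces (inside ∷ T)) graph   ≡⟨ count-inside T ⟩
      degreeIn T N + m * (∣ T ∣ choose 2)  ≤⟨ +-monoˡ-≤ _ (degreeIn-spread≤copies m X T) ⟩
      m * ∣ T ∣ + m * (∣ T ∣ choose 2)     ≡⟨ m*[1+t]choose2 ∣ T ∣ ⟩
      m * (suc ∣ T ∣ choose 2)             ≤⟨ sparseK (suc ∣ T ∣) t<p ⟩
      k * suc ∣ T ∣ ∸ ℓ                    ∎
      where open ≤-Reasoning
    ... | inj₂ t≡p = ≤-trans (≤-reflexive (count-inside T))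
      (subst (λ t → degreeIn T N + m * (t choose 2) ≤ k * suc t ∸ ℓ) (sym t≡p)
             (≤-trans (+-monoˡ-≤ _ (degreeIn-spread≤total m X T)) (≤-reflexive X+m*[pC2]≡k*[1+p]∸ℓ)))

    graph-size : length graph + ℓ ≡ k * suc p
    graph-size = begin
      length graph + ℓ                     ≡⟨ cong (_+ ℓ) (length-extend 0 N (complete p)) ⟩
      length N + length (complete p) + ℓ   ≡⟨ cong₂ (λ a b → a + b + ℓ) (length-spread m p X≤p*m) (length-complete p) ⟩
      X + m * (p choose 2) + ℓ             ≡⟨ cong (_+ ℓ) X+m*[pC2]≡k*[1+p]∸ℓ ⟩
      k * suc p ∸ ℓ + ℓ                    ≡⟨ m∸n+n≡m ℓ≤k*[1+p] ⟩
      k * suc p                            ∎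
      where
      open ≡-Reasoning
      ℓ≤k*[1+p] : ℓ ≤ k * suc p
      ℓ≤k*[1+p] = ≤-trans (<⇒≤ ℓ<2k) (≤-trans (≤-reflexive (*-comm 2 k)) (*-monoʳ-≤ k (s≤s p≥1)))

    tight : TightIn (suc p) k ℓ
    tight = record
      { graph   = graph
      ; sparse  = graph-sparse
      ; withinK = extend-withinK {k = k} {ℓ} {N = N} {complete p} z≤n (multiplicity-spread m X) (complete-withinK p)
      ; size    = graph-size
      }

  completion : ∀ p → 1 ≤ p → CompleteSparse p → k * suc p ≤ m * (suc p choose 2) + ℓ → TightIn (suc p) k ℓ
  completion = Completion.tight

  single-vertex : ℓ ≤ k → TightIn 1 k ℓ
  single-vertex ℓ≤k = record
    { graph   = extend (k ∸ ℓ) [] []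
    ; sparse  = sparse
    ; withinK = extend-withinK {k = k} {ℓ} {N = []} {[]} ≤-refl (λ ()) (λ ())
    ; size    = trans (cong (_+ ℓ) (length-extend (k ∸ ℓ) [] [])) k∸ℓ+0+ℓ≡k*1
    }
    where
    k∸ℓ+0+ℓ≡k*1 : k ∸ ℓ + 0 + ℓ ≡ k * 1
    k∸ℓ+0+ℓ≡k*1 = trans (cong (_+ ℓ) (+-identityʳ (k ∸ ℓ))) (trans (m∸n+n≡m ℓ≤k) (sym (*-identityʳ k)))
    sparse : IsSparseGraph k ℓ (extend (k ∸ ℓ) [] [])
    sparse (outside ∷ []) = ≤-trans (≤-reflexive (count-extend outside [] (k ∸ ℓ) [] [])) z≤n
    sparse (inside  ∷ []) = ≤-reflexive (trans (count-extend inside [] (k ∸ ℓ) [] [])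
      (trans (+-identityʳ (k ∸ ℓ + 0)) (trans (+-identityʳ (k ∸ ℓ)) (cong (_∸ ℓ) (sym (*-identityʳ k))))))

  double-vertex : TightIn 2 k ℓ
  double-vertex = completion 1 ≤-refl complete-sparse-1 (≤-reflexive (begin
    k * 2          ≡⟨ *-comm k 2 ⟩
    2 * k          ≡⟨ ℓ+m≡2k ⟨
    ℓ + m          ≡⟨ +-comm ℓ m ⟩
    m + ℓ          ≡⟨ cong (_+ ℓ) (*-identityʳ m) ⟨
    m * 1 + ℓ      ∎))
    where open ≡-Reasoning

  2ℓ+2m≡4k : 2 * ℓ + 2 * m ≡ 4 * k
  2ℓ+2m≡4k = begin
    2 * ℓ + 2 * m   ≡⟨ *-distribˡ-+ 2 ℓ m ⟨
    2 * (ℓ + m)     ≡⟨ cong (2 *_) ℓ+m≡2k ⟩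
    2 * (2 * k)     ≡⟨ *-assoc 2 2 k ⟨
    4 * k           ∎
    where open ≡-Reasoning

  k≤m : ℓ ≤ k → k ≤ m
  k≤m ℓ≤k = +-cancelˡ-≤ ℓ k m (begin
    ℓ + k           ≤⟨ +-monoˡ-≤ k ℓ≤k ⟩
    k + k           ≡⟨ cong (k +_) (+-identityʳ k) ⟨
    2 * k           ≡⟨ ℓ+m≡2k ⟨
    ℓ + m           ∎)
    where open ≤-Reasoning

  k<2m : 2 * ℓ < 3 * k → k < 2 * m
  k<2m 2ℓ<3k = +-cancelˡ-< (2 * ℓ) k (2 * m) (begin-strict
    2 * ℓ + k       <⟨ +-monoˡ-< k 2ℓ<3k ⟩
    3 * k + k       ≡⟨ +-comm (3 * k) k ⟩
    4 * k           ≡⟨ 2ℓ+2m≡4k ⟨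
    2 * ℓ + 2 * m   ∎)
    where open ≤-Reasoning

  2m≤k : 3 * k ≤ 2 * ℓ → 2 * m ≤ k
  2m≤k 3k≤2ℓ = +-cancelˡ-≤ (2 * ℓ) (2 * m) k (begin
    2 * ℓ + 2 * m   ≡⟨ 2ℓ+2m≡4k ⟩
    4 * k           ≡⟨ +-comm k (3 * k) ⟩
    3 * k + k       ≤⟨ +-monoˡ-≤ k 3k≤2ℓ ⟩
    2 * ℓ + k       ∎)
    where open ≤-Reasoning

  0<m : 0 < m
  0<m = m+n≤o⇒m≤o∸n 1 ℓ<2k

  k<2k : k < 2 * k
  k<2k = n<2*n (*-cancelˡ-< 2 0 k (≤-<-trans z≤n ℓ<2k))

  m≤k : 3 * k ≤ 2 * ℓ → m ≤ k
  m≤k 3k≤2ℓ = ≤-trans (m≤m+n m (m + 0)) (2m≤k 3k≤2ℓ)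

  large-ℓ : 3 * k ≤ 2 * ℓ → ∀ {n} → ℓ ≤ n * m → TightIn n k ℓ
  large-ℓ 3k≤2ℓ {n} ℓ≤nm with ceiling-quotient (2 * k) m {{>-nonZero 0<m}} (≤-trans (s≤s z≤n) ℓ<2k)
  ... | zero        , _     , 2k≤m  =
    contradiction (≤-trans 2k≤m (≤-trans (≤-reflexive (*-identityʳ m)) (m≤k 3k≤2ℓ))) (<⇒≱ k<2k)
  ... | suc zero    , _     , 2k≤2m =
    contradiction (≤-trans 2k≤2m (≤-trans (≤-reflexive (*-comm m 2)) (2m≤k 3k≤2ℓ))) (<⇒≱ k<2k)
  ... | suc (suc s) , mq<2k , 2k≤m[1+q] =
    grow-from k≤qm
      (completion (suc s) (s≤s z≤n) (complete-sparse (suc s) (<⇒≤ mq<2k)) (complete-dense-at s 2k≤m[1+q]))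
      q≤n
    where
    q = suc (suc s)
    k≤qm : k ≤ q * m
    k≤qm = +-cancelʳ-≤ m k (q * m) (begin
      k + m          ≤⟨ +-monoʳ-≤ k (m≤k 3k≤2ℓ) ⟩
      k + k          ≡⟨ cong (k +_) (+-identityʳ k) ⟨
      2 * k          ≤⟨ 2k≤m[1+q] ⟩
      m * suc q      ≡⟨ *-suc m q ⟩
      m + m * q      ≡⟨ +-comm m (m * q) ⟩
      m * q + m      ≡⟨ cong (_+ m) (*-comm m q) ⟩
      q * m + m      ∎)
      where open ≤-Reasoning
    q≤n : q ≤ n
    q≤n = s≤s⁻¹ (*-cancelˡ-< m q (suc n) (begin-strict
      m * q          <⟨ mq<2k ⟩
      2 * k          ≡⟨ ℓ+m≡2k ⟨
      ℓ + m          ≤⟨ +-monoˡ-≤ m ℓ≤nm ⟩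
      n * m + m      ≡⟨ +-comm (n * m) m ⟩
      m + n * m      ≡⟨ cong (m +_) (*-comm n m) ⟩
      m + m * n      ≡⟨ *-suc m n ⟨
      m * suc n      ∎))
      where open ≤-Reasoning

tight-exists : ∀ k ℓ n → 1 ≤ k → Range k ℓ n → TightIn n k ℓ
tight-exists k ℓ n k≥1 (inj₁ (ℓ≤k , n≥1)) =
  grow-from (≤-trans (k≤m ℓ≤k) (≤-reflexive (sym (*-identityˡ m)))) (single-vertex ℓ≤k) n≥1
  where open Construction k ℓ (≤-<-trans ℓ≤k (n<2*n k≥1))
tight-exists k ℓ n _ (inj₂ (inj₁ (_ , 2ℓ<3k , n≥2))) =
  grow-from (<⇒≤ (k<2m 2ℓ<3k)) double-vertex n≥2
  where
  ℓ<2k : ℓ < 2 * k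
  ℓ<2k = *-cancelˡ-< 2 ℓ (2 * k) (<-≤-trans 2ℓ<3k (≤-trans (*-monoˡ-≤ k (n≤1+n 3)) (≤-reflexive (*-assoc 2 2 k))))
  open Construction k ℓ ℓ<2k
tight-exists k ℓ n _ (inj₂ (inj₂ (_     , ℓ<2k , inj₁ refl))) = Construction.double-vertex k ℓ ℓ<2k
tight-exists k ℓ n _ (inj₂ (inj₂ (3k≤2ℓ , ℓ<2k , inj₂ ℓ≤nm))) = Construction.large-ℓ k ℓ ℓ<2k 3k≤2ℓ ℓ≤nm

theorem2 : (k ℓ n : ℕ) → 1 ≤ k → Range k ℓ n →
    IsMatroidBases (#E n k ℓ) (Tight n k ℓ)
theorem2 k ℓ n k≥1 range = TightIn⇒Tight (tight-exists k ℓ n k≥1 range) , tight-exchange n k ℓ
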